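{- For every integer $\ell\ge 3$, the maximum of $R(T)$ over all proper binary trees $T$ with $\ell$ leaves equals $2(\ell-\lfloor\log_2\ell\rfloor-1)+z(\ell)$.
   Context: All trees are rooted; for a vertex $v$ of $T$, $T(v)$ is the subtree induced by $v$ and its descendants, and a leaf is a vertex with no children. The rank of $v$ is $R_T(v)=\min d(u,v)$ over leaves $u$ of $T(v)$, and the security is $R(T)=\sum_{v\in V(T)}R_T(v)$. A proper binary tree is an unordered rooted tree in which every non-leaf vertex has exactly two children. $z(\ell)$ denotes the number of digits equal to $0$ in the binary expansion of $\ell$ (which has $\lfloor\log_2\ell\rfloor+1$ digits); equivalently, if $\ell$ is a sum of $k$ distinct powers of two, then $z(\ell)=\lfloor\log_2\ell\rfloor+1-k$. -}

module Defs where

open import Data.Nat using (ℕ; zero; suc; _+_; _*_; _∸_; _⊓_; _≤_; _%_; _/_)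
open import Data.Nat.Logarithm using (⌊log₂_⌋)
open import Data.List using (List; []; _∷_; _++_; map; foldr)
open import Data.Nat.ListAction using (sum)
open import Data.Maybe using (Maybe; just; nothing)

-- Proper binary trees: a vertex is either a leaf or has exactly two children.
-- (Unordered in the paper; the order of children is irrelevant for every
-- quantity below, and every unordered tree has an ordered representative.)
data PBT : Set where
  leaf : PBT
  node : PBT → PBT → PBT

leaves : PBT → ℕ
leaves leaf       = 1
leaves (node l r) = leaves l + leaves r

leafDepths : PBT → List ℕ
leafDepths leaf       = 0 ∷ []
leafDepths (node l r) = map suc (leafDepths l ++ leafDepths r)

minList : List ℕ → ℕ
minList []       = 0
minList (x ∷ xs) = foldr _⊓_ x xs

rankRoot : PBT → ℕ
rankRoot t = minList (leafDepths t)

-- ranks R_T(v) of all vertices v of T (vertex v has subtree T(v))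
ranks : PBT → List ℕ
ranks leaf       = rankRoot leaf ∷ []
ranks (node l r) = rankRoot (node l r) ∷ (ranks l ++ ranks r)

security : PBT → ℕ
security t = sum (ranks t)

-- number of 0 digits in the binary expansion of n (n ≥ 1), with fuel
zerosAux : ℕ → ℕ → ℕ
zerosAux zero    n = 0
zerosAux (suc f) zero = 0
zerosAux (suc f) (suc zero) = 0
zerosAux (suc f) n@(suc (suc _)) with n % 2
... | zero  = suc (zerosAux f (n / 2))
... | suc _ = zerosAux f (n / 2)

z : ℕ → ℕ
z n = zerosAux n n

maxSecurity : ℕ → ℕ
maxSecurity ℓ = 2 * (ℓ ∸ ⌊log₂ ℓ ⌋ ∸ 1) + z ℓ

-- Write M(ℓ) = 2(ℓ − ⌊log₂ ℓ⌋ − 1) + z(ℓ). Appending a binary digit to n ≥ 1 raises ⌊log₂ n⌋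
-- by one and raises z(n) by one exactly when the digit is 0; hence M(1) = 0 and
-- M(a) + 1 = M(⌊a/2⌋) + a for a ≥ 2. Along binary expansions this makes M strictly increasing
-- and gives M(a) + M(b) + m + 1 ≤ M(a + b) whenever 2^m ≤ a and 2^m ≤ b.
-- The root of node l r has rank m + 1 with m = min(rank l, rank r), and a tree of rank m has at
-- least 2^m leaves, so R(T) ≤ M(ℓ) by induction on T. Conversely, splitting every leaf of an
-- optimal tree with ⌊ℓ/2⌋ leaves into a cherry (and, for odd ℓ, one of them into three leaves)
-- raises every old rank by one, so the security grows by exactly what the recurrence for M adds.
module Submission where

open import Data.List using ([]; _∷_; _++_; map; foldr)
open import Data.Nat
open import Data.Nat.DivMod
open import Data.Nat.Divisibility using (divides)
open import Data.Nat.ListAction.Properties using (sum-++)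
open import Data.Nat.Logarithm
open import Data.Nat.Properties
open import Algebra.Properties.CommutativeSemigroup ⊓-commutativeSemigroup using (x∙yz≈y∙xz)
open import Data.Nat.Tactic.RingSolver using (solve-∀)
open import Data.Product using (∃-syntax; ∃₂; _×_; _,_)
open import Relation.Binary.PropositionalEquality

open import Defs

private
  variable
    a b m n : ℕ

⊓-foldr-swap : ∀ x y zs → x ⊓ foldr _⊓_ y zs ≡ y ⊓ foldr _⊓_ x zs
⊓-foldr-swap x y []       = ⊓-comm x y
⊓-foldr-swap x y (z ∷ zs) = begin
  x ⊓ (z ⊓ foldr _⊓_ y zs) ≡⟨ x∙yz≈y∙xz x z _ ⟩
  z ⊓ (x ⊓ foldr _⊓_ y zs) ≡⟨ cong (z ⊓_) (⊓-foldr-swap x y zs) ⟩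
  z ⊓ (y ⊓ foldr _⊓_ x zs) ≡⟨ x∙yz≈y∙xz z y _ ⟩
  y ⊓ (z ⊓ foldr _⊓_ x zs) ∎
  where open ≡-Reasoning

minList-++ : ∀ x xs y ys → minList (x ∷ xs ++ y ∷ ys) ≡ minList (x ∷ xs) ⊓ minList (y ∷ ys)
minList-++ x []        y ys = ⊓-foldr-swap y x ys
minList-++ x (x′ ∷ xs) y ys = begin
  x′ ⊓ minList (x ∷ xs ++ y ∷ ys)            ≡⟨ cong (x′ ⊓_) (minList-++ x xs y ys) ⟩
  x′ ⊓ (minList (x ∷ xs) ⊓ minList (y ∷ ys)) ≡⟨ ⊓-assoc x′ _ _ ⟨
  x′ ⊓ minList (x ∷ xs) ⊓ minList (y ∷ ys)   ∎
  where open ≡-Reasoning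

minList-map-suc : ∀ x xs → minList (map suc (x ∷ xs)) ≡ suc (minList (x ∷ xs))
minList-map-suc x []        = refl
minList-map-suc x (x′ ∷ xs) = cong (suc x′ ⊓_) (minList-map-suc x xs)

leafDepths-nonEmpty : ∀ t → ∃₂ λ d ds → leafDepths t ≡ d ∷ ds
leafDepths-nonEmpty leaf       = 0 , [] , refl
leafDepths-nonEmpty (node l r) with leafDepths-nonEmpty l
... | d , ds , eq rewrite eq = suc d , map suc (ds ++ leafDepths r) , refl

rankRoot-node : ∀ l r → rankRoot (node l r) ≡ suc (rankRoot l ⊓ rankRoot r)
rankRoot-node l r with leafDepths-nonEmpty l | leafDepths-nonEmpty r
... | d , ds , eqˡ | e , es , eqʳ = begin
  minList (map suc (leafDepths l ++ leafDepths r)) ≡⟨ cong₂ (λ xs ys → minList (map suc (xs ++ ys))) eqˡ eqʳ ⟩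
  minList (map suc (d ∷ ds ++ e ∷ es))             ≡⟨ minList-map-suc d (ds ++ e ∷ es) ⟩
  suc (minList (d ∷ ds ++ e ∷ es))                 ≡⟨ cong suc (minList-++ d ds e es) ⟩
  suc (minList (d ∷ ds) ⊓ minList (e ∷ es))        ≡⟨ cong₂ (λ xs ys → suc (minList xs ⊓ minList ys)) eqˡ eqʳ ⟨
  suc (rankRoot l ⊓ rankRoot r)                    ∎
  where open ≡-Reasoning

security-node : ∀ l r → security (node l r) ≡ suc (rankRoot l ⊓ rankRoot r) + (security l + security r)
security-node l r = cong₂ _+_ (rankRoot-node l r) (sum-++ (ranks l) (ranks r))

2^rankRoot≤leaves : ∀ t → 2 ^ rankRoot t ≤ leaves t
2^[rankRoot⊓]≤leavesˡ : ∀ l r → 2 ^ (rankRoot l ⊓ rankRoot r) ≤ leaves l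
2^[rankRoot⊓]≤leavesʳ : ∀ l r → 2 ^ (rankRoot l ⊓ rankRoot r) ≤ leaves r

2^rankRoot≤leaves leaf       = ≤-refl
2^rankRoot≤leaves (node l r) rewrite rankRoot-node l r =
  +-mono-≤ (2^[rankRoot⊓]≤leavesˡ l r)
           (≤-trans (≤-reflexive (+-identityʳ _)) (2^[rankRoot⊓]≤leavesʳ l r))

2^[rankRoot⊓]≤leavesˡ l r =
  ≤-trans (^-monoʳ-≤ 2 (m⊓n≤m (rankRoot l) (rankRoot r))) (2^rankRoot≤leaves l)
2^[rankRoot⊓]≤leavesʳ l r =
  ≤-trans (^-monoʳ-≤ 2 (m⊓n≤n (rankRoot l) (rankRoot r))) (2^rankRoot≤leaves r)

data Binary : ℕ → Set where
  one  : Binary 1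
  even : Binary (suc n) → Binary (2 * suc n)
  odd  : Binary (suc n) → Binary (suc (2 * suc n))

increment : Binary n → Binary (suc n)
increment one         = even one
increment (even b)    = odd b
increment (odd {n} b) = subst Binary (*-suc 2 (suc n)) (even (increment b))

binary : ∀ n .{{_ : NonZero n}} → Binary n
binary (suc zero)    = one
binary (suc (suc n)) = increment (binary (suc n))

n<2*n : ∀ n .{{_ : NonZero n}} → n < 2 * n
n<2*n n = subst (n <_) (*-comm n 2) (m<m*n n 2 (s≤s (s≤s z≤n)))

[2*n]%2≡0 : ∀ n → (2 * n) % 2 ≡ 0
[2*n]%2≡0 n = trans (cong (_% 2) (*-comm 2 n)) (m*n%n≡0 n 2)

[1+2*n]%2≡1 : ∀ n → suc (2 * n) % 2 ≡ 1
[1+2*n]%2≡1 n = trans (cong (λ k → suc k % 2) (*-comm 2 n)) ([m+kn]%n≡m%n 1 n 2)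

[2*n]/2≡n : ∀ n → (2 * n) / 2 ≡ n
[2*n]/2≡n n = trans (cong (_/ 2) (*-comm 2 n)) (m*n/n≡m n 2)

[1+2*n]/2≡n : ∀ n → suc (2 * n) / 2 ≡ n
[1+2*n]/2≡n n = trans (+-distrib-/-∣ʳ 1 (divides n (*-comm 2 n))) ([2*n]/2≡n n)

⌊log₂[1+2*n]⌋≡1+⌊log₂n⌋ : ∀ n .{{_ : NonZero n}} → ⌊log₂ (suc (2 * n)) ⌋ ≡ 1 + ⌊log₂ n ⌋
⌊log₂[1+2*n]⌋≡1+⌊log₂n⌋ n@(suc _) = begin
  ⌊log₂ (suc (2 * n)) ⌋           ≡⟨ m+[n∸m]≡n 1≤⌊log₂[1+2*n]⌋ ⟨
  1 + (⌊log₂ (suc (2 * n)) ⌋ ∸ 1) ≡⟨ cong suc (⌊log₂⌊n/2⌋⌋≡⌊log₂n⌋∸1 (suc (2 * n))) ⟨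
  1 + ⌊log₂ ⌊ suc (2 * n) /2⌋ ⌋   ≡⟨ cong (λ k → 1 + ⌊log₂ ⌊ suc (n + k) /2⌋ ⌋) (+-identityʳ n) ⟩
  1 + ⌊log₂ ⌈ n + n /2⌉ ⌋         ≡⟨ cong (λ k → 1 + ⌊log₂ k ⌋) (n≡⌈n+n/2⌉ n) ⟨
  1 + ⌊log₂ n ⌋                   ∎
  where
  open ≡-Reasoning
  1≤⌊log₂[1+2*n]⌋ : 1 ≤ ⌊log₂ (suc (2 * n)) ⌋
  1≤⌊log₂[1+2*n]⌋ = ⌊log₂⌋-mono-≤ {2} {suc (2 * n)} (s≤s (s≤s z≤n))

⌊log₂n⌋<n : Binary n → ⌊log₂ n ⌋ < n
⌊log₂n⌋<n one          = s≤s z≤n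
⌊log₂n⌋<n (even {n} b) = subst (_< 2 * suc n) (sym (⌊log₂[2*b]⌋≡1+⌊log₂b⌋ (suc n)))
  (≤-<-trans (⌊log₂n⌋<n b) (n<2*n (suc n)))
⌊log₂n⌋<n (odd {n} b)  = subst (_< suc (2 * suc n)) (sym (⌊log₂[1+2*n]⌋≡1+⌊log₂n⌋ (suc n)))
  (≤-<-trans (⌊log₂n⌋<n b) (s≤s (m≤n*m (suc n) 2)))

zerosAux-zero : ∀ f → zerosAux f 0 ≡ 0
zerosAux-zero zero    = refl
zerosAux-zero (suc f) = refl

n≤1+k⇒n/2≤k : ∀ {n k} .{{_ : NonZero n}} → n ≤ suc k → n / 2 ≤ k
n≤1+k⇒n/2≤k {n} n≤1+k = ≤-pred (≤-trans (m/n<m n 2 (s≤s (s≤s z≤n))) n≤1+k)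

zerosAux-fuel : ∀ {f g} n → n ≤ f → n ≤ g → zerosAux f n ≡ zerosAux g n
zerosAux-fuel {f}     {g}     zero           _     _     = trans (zerosAux-zero f) (sym (zerosAux-zero g))
zerosAux-fuel {suc f} {suc g} (suc zero)     _     _     = refl
zerosAux-fuel {suc f} {suc g} n@(suc (suc _)) n≤1+f n≤1+g with n % 2
... | zero  = cong suc (zerosAux-fuel (n / 2) (n≤1+k⇒n/2≤k n≤1+f) (n≤1+k⇒n/2≤k n≤1+g))
... | suc _ = zerosAux-fuel (n / 2) (n≤1+k⇒n/2≤k n≤1+f) (n≤1+k⇒n/2≤k n≤1+g)

zerosAux-even : ∀ f n → 2 ≤ n → n % 2 ≡ 0 → zerosAux (suc f) n ≡ suc (zerosAux f (n / 2))
zerosAux-even f (suc (suc _)) _        n%2≡0 rewrite n%2≡0 = refl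
zerosAux-even f (suc zero)    (s≤s ()) _

zerosAux-odd : ∀ f n → 2 ≤ n → n % 2 ≡ 1 → zerosAux (suc f) n ≡ zerosAux f (n / 2)
zerosAux-odd f (suc (suc _)) _        n%2≡1 rewrite n%2≡1 = refl
zerosAux-odd f (suc zero)    (s≤s ()) _

z[2*n]≡1+z[n] : ∀ n .{{_ : NonZero n}} → z (2 * n) ≡ suc (z n)
z[2*n]≡1+z[n] n@(suc _) = begin
  z (2 * n)                                 ≡⟨ zerosAux-even (pred (2 * n)) (2 * n) 2≤2*n ([2*n]%2≡0 n) ⟩
  suc (zerosAux (pred (2 * n)) (2 * n / 2)) ≡⟨ cong (λ k → suc (zerosAux (pred (2 * n)) k)) ([2*n]/2≡n n) ⟩
  suc (zerosAux (pred (2 * n)) n)           ≡⟨ cong suc (zerosAux-fuel n (≤-pred (n<2*n n)) ≤-refl) ⟩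
  suc (z n)                                 ∎
  where
  open ≡-Reasoning
  2≤2*n : 2 ≤ 2 * n
  2≤2*n = *-monoʳ-≤ 2 (s≤s z≤n)

z[1+2*n]≡z[n] : ∀ n .{{_ : NonZero n}} → z (suc (2 * n)) ≡ z n
z[1+2*n]≡z[n] n@(suc _) = begin
  z (suc (2 * n))                    ≡⟨ zerosAux-odd (2 * n) (suc (2 * n)) (s≤s (s≤s z≤n)) ([1+2*n]%2≡1 n) ⟩
  zerosAux (2 * n) (suc (2 * n) / 2) ≡⟨ cong (zerosAux (2 * n)) ([1+2*n]/2≡n n) ⟩
  zerosAux (2 * n) n                 ≡⟨ zerosAux-fuel n (<⇒≤ (n<2*n n)) ≤-refl ⟩
  z n                                ∎
  where open ≡-Reasoning

-- maxSecurity n unfolds to 2 * excess n + z n.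
excess : ℕ → ℕ
excess n = n ∸ ⌊log₂ n ⌋ ∸ 1

n≡1+⌊log₂n⌋+excess[n] : ∀ n .{{_ : NonZero n}} → n ≡ suc (⌊log₂ n ⌋ + excess n)
n≡1+⌊log₂n⌋+excess[n] n = begin
  n                     ≡⟨ m+[n∸m]≡n (⌊log₂n⌋<n (binary n)) ⟨
  suc L + (n ∸ suc L)   ≡⟨ cong (λ k → suc L + (n ∸ k)) (+-comm 1 L) ⟩
  suc L + (n ∸ (L + 1)) ≡⟨ cong (suc L +_) (∸-+-assoc n L 1) ⟨
  suc (L + excess n)    ∎
  where
  open ≡-Reasoning
  L = ⌊log₂ n ⌋

1+excess[2*n]≡excess[n]+n : ∀ n .{{_ : NonZero n}} → suc (excess (2 * n)) ≡ excess n + n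
1+excess[2*n]≡excess[n]+n n@(suc _) = +-cancelˡ-≡ (suc L) _ _ (begin
  suc L + suc (excess (2 * n))           ≡⟨ +-suc (suc L) _ ⟩
  suc (suc L + excess (2 * n))           ≡⟨ cong (λ k → suc (k + excess (2 * n))) (⌊log₂[2*b]⌋≡1+⌊log₂b⌋ n) ⟨
  suc (⌊log₂ (2 * n) ⌋ + excess (2 * n)) ≡⟨ n≡1+⌊log₂n⌋+excess[n] (2 * n) ⟨
  2 * n                                  ≡⟨ cong (n +_) (+-identityʳ n) ⟩
  n + n                                  ≡⟨ cong (_+ n) (n≡1+⌊log₂n⌋+excess[n] n) ⟩
  suc L + excess n + n                   ≡⟨ +-assoc (suc L) (excess n) n ⟩
  suc L + (excess n + n)                 ∎)
  where
  open ≡-Reasoning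
  L = ⌊log₂ n ⌋

excess[1+2*n]≡excess[n]+n : ∀ n .{{_ : NonZero n}} → excess (suc (2 * n)) ≡ excess n + n
excess[1+2*n]≡excess[n]+n n@(suc _) = +-cancelˡ-≡ (suc L) _ _ (suc-injective (begin
  suc (suc L + e)                      ≡⟨ cong (λ k → suc (k + e)) (⌊log₂[1+2*n]⌋≡1+⌊log₂n⌋ n) ⟨
  suc (⌊log₂ (suc (2 * n)) ⌋ + e)      ≡⟨ n≡1+⌊log₂n⌋+excess[n] (suc (2 * n)) ⟨
  suc (2 * n)                          ≡⟨ cong (λ k → suc (n + k)) (+-identityʳ n) ⟩
  suc (n + n)                          ≡⟨ cong (λ k → suc (k + n)) (n≡1+⌊log₂n⌋+excess[n] n) ⟩
  suc (suc L + excess n + n)           ≡⟨ cong suc (+-assoc (suc L) (excess n) n) ⟩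
  suc (suc L + (excess n + n))         ∎))
  where
  open ≡-Reasoning
  L = ⌊log₂ n ⌋
  e = excess (suc (2 * n))

maxSecurity-even : ∀ n .{{_ : NonZero n}} → suc (maxSecurity (2 * n)) ≡ maxSecurity n + 2 * n
maxSecurity-even n = begin
  suc (2 * excess (2 * n) + z (2 * n)) ≡⟨ cong (λ k → suc (2 * excess (2 * n) + k)) (z[2*n]≡1+z[n] n) ⟩
  suc (2 * excess (2 * n) + suc (z n)) ≡⟨ lemma₁ (excess (2 * n)) (z n) ⟩
  2 * suc (excess (2 * n)) + z n       ≡⟨ cong (λ k → 2 * k + z n) (1+excess[2*n]≡excess[n]+n n) ⟩
  2 * (excess n + n) + z n             ≡⟨ lemma₂ (excess n) n (z n) ⟩
  2 * excess n + z n + 2 * n           ∎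
  where
  open ≡-Reasoning
  lemma₁ : ∀ e k → suc (2 * e + suc k) ≡ 2 * suc e + k
  lemma₁ = solve-∀
  lemma₂ : ∀ e n k → 2 * (e + n) + k ≡ 2 * e + k + 2 * n
  lemma₂ = solve-∀

maxSecurity-odd : ∀ n .{{_ : NonZero n}} → suc (maxSecurity (suc (2 * n))) ≡ maxSecurity n + suc (2 * n)
maxSecurity-odd n = begin
  suc (2 * excess (suc (2 * n)) + z (suc (2 * n)))
    ≡⟨ cong₂ (λ e k → suc (2 * e + k)) (excess[1+2*n]≡excess[n]+n n) (z[1+2*n]≡z[n] n) ⟩
  suc (2 * (excess n + n) + z n)
    ≡⟨ lemma (excess n) n (z n) ⟩
  2 * excess n + z n + suc (2 * n)
    ∎
  where
  open ≡-Reasoning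
  lemma : ∀ e n k → suc (2 * (e + n) + k) ≡ 2 * e + k + suc (2 * n)
  lemma = solve-∀

maxSecurity-<-suc : Binary n → maxSecurity n < maxSecurity (suc n)
maxSecurity-<-suc one          = s≤s z≤n
maxSecurity-<-suc (even {n} b) = ≤-reflexive (sym (suc-injective (begin
  suc (maxSecurity (suc (2 * k)))   ≡⟨ maxSecurity-odd k ⟩
  maxSecurity k + suc (2 * k)       ≡⟨ +-suc (maxSecurity k) (2 * k) ⟩
  suc (maxSecurity k + 2 * k)       ≡⟨ cong suc (maxSecurity-even k) ⟨
  suc (suc (maxSecurity (2 * k)))   ∎)))
  where
  open ≡-Reasoning
  k = suc n
maxSecurity-<-suc (odd {n} b)  = s<s⁻¹ (begin-strict
  suc (maxSecurity (suc (2 * k)))         ≡⟨ maxSecurity-odd k ⟩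
  maxSecurity k + suc (2 * k)             <⟨ +-monoˡ-< _ (maxSecurity-<-suc b) ⟩
  maxSecurity (suc k) + suc (2 * k)       ≤⟨ +-monoʳ-≤ _ (n≤1+n _) ⟩
  maxSecurity (suc k) + suc (suc (2 * k)) ≡⟨ cong (maxSecurity (suc k) +_) (*-suc 2 k) ⟨
  maxSecurity (suc k) + 2 * suc k         ≡⟨ maxSecurity-even (suc k) ⟨
  suc (maxSecurity (2 * suc k))           ≡⟨ cong (λ j → suc (maxSecurity j)) (*-suc 2 k) ⟩
  suc (maxSecurity (suc (suc (2 * k))))   ∎)
  where
  open ≤-Reasoning
  k = suc n

2^m≤1⇒m≡0 : 2 ^ m ≤ 1 → m ≡ 0
2^m≤1⇒m≡0 {zero}  _     = refl
2^m≤1⇒m≡0 {suc m} 2^m≤1 with ≤-trans (*-monoʳ-≤ 2 (m^n>0 2 m)) 2^m≤1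
... | s≤s ()

2^m≤1+2n⇒2^pred[m]≤n : ∀ m .{{_ : NonZero n}} → 2 ^ m ≤ suc (2 * n) → 2 ^ pred m ≤ n
2^m≤1+2n⇒2^pred[m]≤n {suc n} zero    _        = s≤s z≤n
2^m≤1+2n⇒2^pred[m]≤n {n}     (suc m) 2^m≤1+2n = s≤s⁻¹ (*-cancelˡ-< 2 (2 ^ m) (suc n)
  (subst (suc (2 * 2 ^ m) ≤_) (sym (*-suc 2 n)) (s≤s 2^m≤1+2n)))

superadditive-step : ∀ a′ b′ c′ {c} →
                     suc (maxSecurity a) ≡ maxSecurity a′ + a →
                     suc (maxSecurity b) ≡ maxSecurity b′ + b →
                     suc (maxSecurity c) ≡ maxSecurity c′ + c → c ≡ a + b →
                     maxSecurity a′ + maxSecurity b′ + m ≤ maxSecurity c′ →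
                     maxSecurity a + maxSecurity b + suc m ≤ maxSecurity (a + b)
superadditive-step {a} {b} {m} a′ b′ c′ eqᵃ eqᵇ eqᶜ refl ih = s≤s⁻¹ (s≤s⁻¹ (begin
  suc (suc (M a + M b + suc m))  ≡⟨ lemma₁ (M a) (M b) m ⟩
  suc (M a) + suc (M b) + suc m  ≡⟨ cong₂ (λ p q → p + q + suc m) eqᵃ eqᵇ ⟩
  M a′ + a + (M b′ + b) + suc m  ≡⟨ lemma₂ (M a′) a (M b′) b m ⟩
  M a′ + M b′ + m + suc (a + b)  ≤⟨ +-monoˡ-≤ (suc (a + b)) ih ⟩
  M c′ + suc (a + b)             ≡⟨ +-suc (M c′) (a + b) ⟩
  suc (M c′ + (a + b))           ≡⟨ cong suc eqᶜ ⟨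
  suc (suc (M (a + b)))          ∎))
  where
  open ≤-Reasoning
  M = maxSecurity
  lemma₁ : ∀ x y m → suc (suc (x + y + suc m)) ≡ suc x + suc y + suc m
  lemma₁ = solve-∀
  lemma₂ : ∀ x a y b m → x + a + (y + b) + suc m ≡ x + y + m + suc (a + b)
  lemma₂ = solve-∀

superadditive-comm : ∀ a b → maxSecurity b + maxSecurity a + suc m ≤ maxSecurity (b + a) →
                     maxSecurity a + maxSecurity b + suc m ≤ maxSecurity (a + b)
superadditive-comm {m} a b =
  subst₂ (λ p q → p + suc m ≤ maxSecurity q) (+-comm (maxSecurity b) (maxSecurity a)) (+-comm b a)

superadditive : Binary a → Binary b → 2 ^ m ≤ a → 2 ^ m ≤ b →
                maxSecurity a + maxSecurity b + suc m ≤ maxSecurity (a + b)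
superadditive-halves : .{{_ : NonZero a}} .{{_ : NonZero b}} → Binary a → Binary b →
                       2 ^ m ≤ suc (2 * a) → 2 ^ m ≤ suc (2 * b) →
                       maxSecurity a + maxSecurity b + m ≤ maxSecurity (a + b)
superadditive-even-odd : Binary (suc a) → Binary (suc b) →
                         2 ^ m ≤ 2 * suc a → 2 ^ m ≤ suc (2 * suc b) →
                         maxSecurity (2 * suc a) + maxSecurity (suc (2 * suc b)) + suc m ≤
                         maxSecurity (2 * suc a + suc (2 * suc b))

superadditive {b = b} {m} one y 2^m≤1 _ rewrite 2^m≤1⇒m≡0 {m} 2^m≤1 =
  subst (_≤ maxSecurity (suc b)) (+-comm 1 (maxSecurity b)) (maxSecurity-<-suc y)
superadditive {a} x one 2^m≤a 2^m≤1 = superadditive-comm a 1 (superadditive one x 2^m≤1 2^m≤a)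
superadditive (even {i} x) (even {j} y) 2^m≤a 2^m≤b =
  superadditive-step (suc i) (suc j) (suc i + suc j)
    (maxSecurity-even (suc i)) (maxSecurity-even (suc j)) (maxSecurity-even (suc i + suc j))
    (*-distribˡ-+ 2 (suc i) (suc j))
    (superadditive-halves x y (m≤n⇒m≤1+n 2^m≤a) (m≤n⇒m≤1+n 2^m≤b))
superadditive (even x) (odd y) 2^m≤a 2^m≤b = superadditive-even-odd x y 2^m≤a 2^m≤b
superadditive {a} {b} (odd x) (even y) 2^m≤a 2^m≤b =
  superadditive-comm a b (superadditive-even-odd y x 2^m≤b 2^m≤a)
superadditive (odd {i} x) (odd {j} y) 2^m≤a 2^m≤b =
  superadditive-step (suc i) (suc j) (suc (suc i + suc j))
    (maxSecurity-odd (suc i)) (maxSecurity-odd (suc j)) (maxSecurity-even (suc (suc i + suc j)))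
    (2[p+q+1]≡[2p+1]+[2q+1] (suc i) (suc j))
    (≤-trans (superadditive-halves x y 2^m≤a 2^m≤b)
             (<⇒≤ (maxSecurity-<-suc (binary (suc i + suc j)))))
  where
  2[p+q+1]≡[2p+1]+[2q+1] : ∀ p q → 2 * suc (p + q) ≡ suc (2 * p) + suc (2 * q)
  2[p+q+1]≡[2p+1]+[2q+1] = solve-∀

superadditive-even-odd {i} {j} x y 2^m≤a 2^m≤b =
  superadditive-step (suc i) (suc j) (suc i + suc j)
    (maxSecurity-even (suc i)) (maxSecurity-odd (suc j)) (maxSecurity-odd (suc i + suc j))
    (2[p+q]+1≡2p+[2q+1] (suc i) (suc j))
    (superadditive-halves x y (m≤n⇒m≤1+n 2^m≤a) 2^m≤b)
  where
  2[p+q]+1≡2p+[2q+1] : ∀ p q → suc (2 * (p + q)) ≡ 2 * p + suc (2 * q)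
  2[p+q]+1≡2p+[2q+1] = solve-∀

superadditive-halves {m = m} x y 2^m≤1+2a 2^m≤1+2b =
  ≤-trans (+-monoʳ-≤ _ (n≤1+pred[n] m))
    (superadditive x y (2^m≤1+2n⇒2^pred[m]≤n m 2^m≤1+2a) (2^m≤1+2n⇒2^pred[m]≤n m 2^m≤1+2b))
  where
  n≤1+pred[n] : ∀ n → n ≤ suc (pred n)
  n≤1+pred[n] zero    = z≤n
  n≤1+pred[n] (suc n) = ≤-refl

maxSecurity-superadditive : 2 ^ m ≤ a → 2 ^ m ≤ b →
                            maxSecurity a + maxSecurity b + suc m ≤ maxSecurity (a + b)
maxSecurity-superadditive {m} {a} {b} 2^m≤a 2^m≤b =
  superadditive (binary a {{positive 2^m≤a}}) (binary b {{positive 2^m≤b}}) 2^m≤a 2^m≤b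
  where
  positive : ∀ {n} → 2 ^ m ≤ n → NonZero n
  positive 2^m≤n = >-nonZero (≤-trans (m^n>0 2 m) 2^m≤n)

security≤maxSecurity : ∀ t → security t ≤ maxSecurity (leaves t)
security≤maxSecurity leaf       = z≤n
security≤maxSecurity (node l r) = begin
  security (node l r)
    ≡⟨ security-node l r ⟩
  suc k + (security l + security r)
    ≤⟨ +-monoʳ-≤ (suc k) (+-mono-≤ (security≤maxSecurity l) (security≤maxSecurity r)) ⟩
  suc k + (M (leaves l) + M (leaves r))
    ≡⟨ +-comm (suc k) _ ⟩
  M (leaves l) + M (leaves r) + suc k
    ≤⟨ maxSecurity-superadditive (2^[rankRoot⊓]≤leavesˡ l r) (2^[rankRoot⊓]≤leavesʳ l r) ⟩
  M (leaves l + leaves r)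
    ∎
  where
  open ≤-Reasoning
  M = maxSecurity
  k = rankRoot l ⊓ rankRoot r

double : PBT → PBT
double leaf       = node leaf leaf
double (node l r) = node (double l) (double r)

double+1 : PBT → PBT
double+1 leaf       = node (double leaf) leaf
double+1 (node l r) = node (double+1 l) (double r)

leaves-double : ∀ t → leaves (double t) ≡ 2 * leaves t
leaves-double leaf       = refl
leaves-double (node l r) =
  trans (cong₂ _+_ (leaves-double l) (leaves-double r)) (sym (*-distribˡ-+ 2 (leaves l) (leaves r)))

leaves-double+1 : ∀ t → leaves (double+1 t) ≡ suc (2 * leaves t)
leaves-double+1 leaf       = refl
leaves-double+1 (node l r) =
  trans (cong₂ _+_ (leaves-double+1 l) (leaves-double r))
        (cong suc (sym (*-distribˡ-+ 2 (leaves l) (leaves r))))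

rankRoot-double : ∀ t → rankRoot (double t) ≡ suc (rankRoot t)
rankRoot-double leaf       = refl
rankRoot-double (node l r) = begin
  rankRoot (node (double l) (double r))
    ≡⟨ rankRoot-node (double l) (double r) ⟩
  suc (rankRoot (double l) ⊓ rankRoot (double r))
    ≡⟨ cong₂ (λ p q → suc (p ⊓ q)) (rankRoot-double l) (rankRoot-double r) ⟩
  suc (suc (rankRoot l ⊓ rankRoot r))
    ≡⟨ cong suc (rankRoot-node l r) ⟨
  suc (rankRoot (node l r))
    ∎
  where open ≡-Reasoning

rankRoot-double+1 : ∀ t → rankRoot (double+1 t) ≡ suc (rankRoot t)
rankRoot-double+1 leaf       = refl
rankRoot-double+1 (node l r) = begin
  rankRoot (node (double+1 l) (double r))
    ≡⟨ rankRoot-node (double+1 l) (double r) ⟩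
  suc (rankRoot (double+1 l) ⊓ rankRoot (double r))
    ≡⟨ cong₂ (λ p q → suc (p ⊓ q)) (rankRoot-double+1 l) (rankRoot-double r) ⟩
  suc (suc (rankRoot l ⊓ rankRoot r))
    ≡⟨ cong suc (rankRoot-node l r) ⟨
  suc (rankRoot (node l r))
    ∎
  where open ≡-Reasoning

security-node-grow : ∀ l r l′ r′ →
                     rankRoot l′ ≡ suc (rankRoot l) → rankRoot r′ ≡ suc (rankRoot r) →
                     suc (security l′) ≡ security l + leaves l′ →
                     suc (security r′) ≡ security r + leaves r′ →
                     suc (security (node l′ r′)) ≡ security (node l r) + leaves (node l′ r′)
security-node-grow l r l′ r′ rankˡ rankʳ secˡ secʳ = begin
  suc (security (node l′ r′))
    ≡⟨ cong suc (security-node l′ r′) ⟩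
  suc (suc (rankRoot l′ ⊓ rankRoot r′) + (security l′ + security r′))
    ≡⟨ cong₂ (λ p q → suc (suc (p ⊓ q) + (security l′ + security r′))) rankˡ rankʳ ⟩
  suc (suc (suc k) + (security l′ + security r′))
    ≡⟨ lemma₁ k (security l′) (security r′) ⟩
  suc k + (suc (security l′) + suc (security r′))
    ≡⟨ cong₂ (λ p q → suc k + (p + q)) secˡ secʳ ⟩
  suc k + (security l + leaves l′ + (security r + leaves r′))
    ≡⟨ lemma₂ (suc k) (security l) (leaves l′) (security r) (leaves r′) ⟩
  suc k + (security l + security r) + (leaves l′ + leaves r′)
    ≡⟨ cong (_+ (leaves l′ + leaves r′)) (security-node l r) ⟨
  security (node l r) + leaves (node l′ r′)
    ∎
  where
  open ≡-Reasoning
  k = rankRoot l ⊓ rankRoot r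
  lemma₁ : ∀ k x y → suc (suc (suc k) + (x + y)) ≡ suc k + (suc x + suc y)
  lemma₁ = solve-∀
  lemma₂ : ∀ k x a y b → k + (x + a + (y + b)) ≡ k + (x + y) + (a + b)
  lemma₂ = solve-∀

security-double : ∀ t → suc (security (double t)) ≡ security t + leaves (double t)
security-double leaf       = refl
security-double (node l r) = security-node-grow l r (double l) (double r)
  (rankRoot-double l) (rankRoot-double r) (security-double l) (security-double r)

security-double+1 : ∀ t → suc (security (double+1 t)) ≡ security t + leaves (double+1 t)
security-double+1 leaf       = refl
security-double+1 (node l r) = security-node-grow l r (double+1 l) (double r)
  (rankRoot-double+1 l) (rankRoot-double r) (security-double+1 l) (security-double r)

extremal : Binary n → ∃[ t ] (leaves t ≡ n × security t ≡ maxSecurity n)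
extremal one = leaf , refl , refl
extremal (even {n} b) with extremal b
... | t , leaves≡ , security≡ = double t , leaves≡′ , suc-injective (begin
  suc (security (double t))        ≡⟨ security-double t ⟩
  security t + leaves (double t)   ≡⟨ cong₂ _+_ security≡ leaves≡′ ⟩
  maxSecurity (suc n) + 2 * suc n  ≡⟨ maxSecurity-even (suc n) ⟨
  suc (maxSecurity (2 * suc n))    ∎)
  where
  open ≡-Reasoning
  leaves≡′ = trans (leaves-double t) (cong (2 *_) leaves≡)
extremal (odd {n} b) with extremal b
... | t , leaves≡ , security≡ = double+1 t , leaves≡′ , suc-injective (begin
  suc (security (double+1 t))           ≡⟨ security-double+1 t ⟩
  security t + leaves (double+1 t)      ≡⟨ cong₂ _+_ security≡ leaves≡′ ⟩
  maxSecurity (suc n) + suc (2 * suc n) ≡⟨ maxSecurity-odd (suc n) ⟨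
  suc (maxSecurity (suc (2 * suc n)))   ∎)
  where
  open ≡-Reasoning
  leaves≡′ = trans (leaves-double+1 t) (cong (λ k → suc (2 * k)) leaves≡)

theorem2p9 : (ℓ : ℕ) → 3 ≤ ℓ →
    ((T : PBT) → leaves T ≡ ℓ → security T ≤ maxSecurity ℓ)
    × (∃[ T ] (leaves T ≡ ℓ × security T ≡ maxSecurity ℓ))
theorem2p9 zero ()
theorem2p9 ℓ@(suc _) _ =
  (λ T leaves≡ℓ → subst (λ n → security T ≤ maxSecurity n) leaves≡ℓ (security≤maxSecurity T)) ,
  extremal (binary ℓ)
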